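{- Let $G$ be the undirected graph and $\mathcal{P}$ the path family described in the context. Any reassignment of positive edge weights to $G$ such that all paths in $\mathcal{P}$ remain shortest has aspect ratio $2^{\Omega(n)}$.
   Context: Let $n$ be divisible by $5$ and $m=n/5$. The undirected graph $G$ has vertices $v_i^1,\dots,v_i^5$ for $i=1,\dots,m$; the cycle $C_i$ consists of edges $\{v_i^1,v_i^2\},\{v_i^2,v_i^3\},\{v_i^3,v_i^4\},\{v_i^4,v_i^5\},\{v_i^5,v_i^1\}$. For every $i<m$ the cross-cycle edges are $\{v_i^1,v_{i+1}^1\},\{v_i^2,v_{i+1}^3\},\{v_i^3,v_{i+1}^5\},\{v_i^4,v_{i+1}^2\},\{v_i^5,v_{i+1}^4\}$. Superscripts are taken modulo $5$ in $\{1,\dots,5\}$. The family $\mathcal{P}$: for each $i<m$ and each vertex $v_i^k$, letting $v_{i+1}^j$ be the endpoint of the cross-cycle edge at $v_i^k$ going to $C_{i+1}$, $\mathcal{P}$ contains the path $v_i^k, v_{i+1}^j, v_{i+1}^{j+1}, v_{i+1}^{j+2}$. The aspect ratio of a weighting $w_H$ is $\max_e w_H(e)/\min_e w_H(e)$; $2^{\Omega(n)}$ means at least $2^{cn}$ for an absolute constant $c>0$ and all sufficiently large $n$.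
   Formalization: The reassigned positive edge weights of $G$ are rational. -}

module Defs where

open import Data.Nat as ℕ using (ℕ; zero; suc)
open import Data.Fin using (Fin; zero; suc; toℕ)
open import Data.Product using (Σ; _×_; _,_)
open import Data.Sum using (_⊎_)
open import Data.Rational using (ℚ; 0ℚ; 1ℚ; _+_; _*_; _≤_; _<_)
open import Relation.Binary.PropositionalEquality using (_≡_)

-- Conventions: cycle index i ∈ {0,…,m-1} (paper: 1,…,m),
-- superscript k ∈ Fin 5 = {0,…,4} (paper: 1,…,5, shifted down by one).

V : ℕ → Set
V m = Fin m × Fin 5

next5 : Fin 5 → Fin 5
next5 zero = suc zero
next5 (suc zero) = suc (suc zero)
next5 (suc (suc zero)) = suc (suc (suc zero))
next5 (suc (suc (suc zero))) = suc (suc (suc (suc zero)))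
next5 (suc (suc (suc (suc zero)))) = zero

-- Cross-cycle map: paper (1-indexed) 1↦1, 2↦3, 3↦5, 4↦2, 5↦4;
-- 0-indexed: 0↦0, 1↦2, 2↦4, 3↦1, 4↦3.
cross5 : Fin 5 → Fin 5
cross5 zero = zero
cross5 (suc zero) = suc (suc zero)
cross5 (suc (suc zero)) = suc (suc (suc (suc zero)))
cross5 (suc (suc (suc zero))) = suc zero
cross5 (suc (suc (suc (suc zero)))) = suc (suc (suc zero))

-- Edges of G.
--   cyc i k        : {v_i^k , v_i^{k+1}}        (edges of C_i)
--   cross i j p k  : {v_i^k , v_j^{cross5 k}}   where j = i+1 (so i < m-1)
data Edge (m : ℕ) : Set where
  cyc   : Fin m → Fin 5 → Edge m
  cross : (i j : Fin m) → toℕ j ≡ suc (toℕ i) → Fin 5 → Edge m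

ends : ∀ {m} → Edge m → V m × V m
ends (cyc i k) = ((i , k) , (i , next5 k))
ends (cross i j _ k) = ((i , k) , (j , cross5 k))

Joins : ∀ {m} → Edge m → V m → V m → Set
Joins e u v = (ends e ≡ (u , v)) ⊎ (ends e ≡ (v , u))

data Walk {m : ℕ} : V m → V m → Set where
  []  : ∀ {u} → Walk u u
  step : ∀ {u v x} (e : Edge m) → Joins e u v → Walk v x → Walk u x

len : ∀ {m} → (Edge m → ℚ) → ∀ {u v} → Walk u v → ℚ
len w [] = 0ℚ
len w (step e _ W) = w e + len w W

-- A walk W from u to v is a shortest u–v walk (equivalently path, as
-- weights are positive) under weighting w.
IsShortest : ∀ {m} → (Edge m → ℚ) → ∀ {u v} → Walk u v → Set
IsShortest w {u} {v} W = (W′ : Walk u v) → len w W ≤ len w W′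

-- The paths of 𝒫: for cycle i, next cycle j = i+1 and superscript k,
--   v_i^k , v_j^{σk} , v_j^{σk+1} , v_j^{σk+2}   with σ = cross5.
pPath : ∀ {m} (i j : Fin m) (p : toℕ j ≡ suc (toℕ i)) (k : Fin 5) →
        Walk {m} (i , k) (j , next5 (next5 (cross5 k)))
pPath i j p k =
  step (cross i j p k) (Data.Sum.inj₁ _≡_.refl)
    (step (cyc j (cross5 k)) (Data.Sum.inj₁ _≡_.refl)
      (step (cyc j (next5 (cross5 k))) (Data.Sum.inj₁ _≡_.refl) []))

AllPShortest : ∀ {m} → (Edge m → ℚ) → Set
AllPShortest {m} w = (i j : Fin m) (p : toℕ j ≡ suc (toℕ i)) (k : Fin 5) →
                     IsShortest w (pPath i j p k)

Positive : ∀ {m} → (Edge m → ℚ) → Set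
Positive {m} w = (e : Edge m) → 0ℚ < w e

_^ℚ_ : ℚ → ℕ → ℚ
q ^ℚ zero = 1ℚ
q ^ℚ suc n = q * (q ^ℚ n)

-- (aspect ratio of w)^k ≥ 2^n, i.e. max_e w(e) / min_e w(e) ≥ 2^(n/k):
-- written without division as: some edges e, e′ satisfy
-- 2^n · w(e′)^k ≤ w(e)^k  (for positive w this is exactly (max/min)^k ≥ 2^n).
AspectRatioPowAtLeast : ∀ {m} → (Edge m → ℚ) → (k n : ℕ) → Set
AspectRatioPowAtLeast {m} w k n =
  Σ (Edge m) λ e → Σ (Edge m) λ e′ →
    (((1ℚ + 1ℚ) ^ℚ n) * (w e′ ^ℚ k)) ≤ (w e ^ℚ k)

{-# OPTIONS --safe #-}

-- Let T i be the total weight of the cycle C_i and σ = cross5, i.e. σ k = 2k (mod 5).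
-- Since σ (k + 1) = σ k + 2, the two-edge walk v_i^k, v_i^(k+1), v_(i+1)^(σ(k+1)) has the
-- same ends as the 𝒫-path from v_i^k, so it is at least as long. Summing these five inequalities,
-- every cross edge occurs once on each side, every edge of C_(i+1) twice on the left and
-- every edge of C_i once on the right: 2 T (i+1) ≤ T i. Hence 2^(m-1) T (m-1) ≤ T 0, and a
-- heaviest edge of C_0 (at least T 0 / 5) outweighs a lightest edge of C_(m-1) (at most
-- T (m-1) / 5) by the factor 2^(m-1), whose 10th power is at least 2^(5m) once m ≥ 2.

module Submission where

open import Defs
open import Data.Nat using (ℕ; _≤_; _*_)
open import Data.Product using (Σ; _×_)
open import Data.Rational using (ℚ)

open import Data.Fin using (Fin; zero; suc; toℕ; fromℕ; inject₁)
open import Data.Fin.Properties using (toℕ-inject₁)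
open import Data.List using (allFin)
open import Data.List.Membership.Propositional.Properties using (∈-allFin)
import Data.List.Relation.Unary.All as All
open import Data.Nat as ℕ using (zero; suc; z≤n; s≤s)
import Data.Nat.Properties as ℕ
open import Data.Nat.Tactic.RingSolver using (solve-∀)
open import Data.Product using (_,_; ∃-syntax)
open import Data.Rational as ℚ using (0ℚ; 1ℚ; _+_; -_; nonNegative)
import Data.Rational.Properties as ℚ
open import Data.Rational.Solver using (module +-*-Solver)
open import Algebra.Properties.Monoid.Sum ℚ.+-0-monoid using (sum)
open import Data.Sum using (inj₁)
open import Function using (_∘_)
open import Relation.Binary.Bundles using (DecTotalOrder)
import Relation.Binary.Construct.Flip.EqAndOrd as Flip
open import Relation.Binary.PropositionalEquality using (_≡_; refl; sym; cong)
open import Relation.Nullary.Decidable using (from-yes)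

open +-*-Solver
open ℚ.≤-Reasoning

two five : ℚ
two = 1ℚ + 1ℚ
five = 1ℚ + 1ℚ + 1ℚ + 1ℚ + 1ℚ

0≤1 : 0ℚ ℚ.≤ 1ℚ
0≤1 = from-yes (0ℚ ℚ.≤? 1ℚ)

1≤two : 1ℚ ℚ.≤ two
1≤two = from-yes (1ℚ ℚ.≤? two)

0≤two : 0ℚ ℚ.≤ two
0≤two = ℚ.≤-trans 0≤1 1≤two

*-nonNeg : ∀ {p q} → 0ℚ ℚ.≤ p → 0ℚ ℚ.≤ q → 0ℚ ℚ.≤ p ℚ.* q
*-nonNeg {p} {q} 0≤p 0≤q =
  ℚ.nonNegative⁻¹ _ {{ℚ.nonNeg*nonNeg⇒nonNeg p {{nonNegative 0≤p}} q {{nonNegative 0≤q}}}}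

*-mono-≤-nonNeg : ∀ {p q r s} → 0ℚ ℚ.≤ p → 0ℚ ℚ.≤ r → p ℚ.≤ q → r ℚ.≤ s →
                  p ℚ.* r ℚ.≤ q ℚ.* s
*-mono-≤-nonNeg {p} {q} {r} {s} 0≤p 0≤r p≤q r≤s =
  ℚ.≤-trans (ℚ.*-monoʳ-≤-nonNeg r {{nonNegative 0≤r}} p≤q)
            (ℚ.*-monoˡ-≤-nonNeg q {{nonNegative (ℚ.≤-trans 0≤p p≤q)}} r≤s)

+-cancelˡ-≤ : ∀ r {p q} → r + p ℚ.≤ r + q → p ℚ.≤ q
+-cancelˡ-≤ r {p} {q} r+p≤r+q = begin
  p               ≡⟨ sym (-r+[r+x]≡x p) ⟩
  - r + (r + p)   ≤⟨ ℚ.+-monoʳ-≤ (- r) r+p≤r+q ⟩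
  - r + (r + q)   ≡⟨ -r+[r+x]≡x q ⟩
  q               ∎
  where
  -r+[r+x]≡x : ∀ x → - r + (r + x) ≡ x
  -r+[r+x]≡x = solve 2 (λ r x → :- r :+ (r :+ x) := x) refl r

sum-mono-≤ : ∀ {n} {f g : Fin n → ℚ} → (∀ i → f i ℚ.≤ g i) → sum f ℚ.≤ sum g
sum-mono-≤ {zero}  _   = ℚ.≤-refl
sum-mono-≤ {suc n} f≤g = ℚ.+-mono-≤ (f≤g zero) (sum-mono-≤ (f≤g ∘ suc))

sum-const₅ : ∀ x → sum {5} (λ _ → x) ≡ five ℚ.* x
sum-const₅ = solve 1 (λ x → x :+ (x :+ (x :+ (x :+ (x :+ con 0ℚ))))
                       := (con 1ℚ :+ con 1ℚ :+ con 1ℚ :+ con 1ℚ :+ con 1ℚ) :* x) refl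

module _ where
  open DecTotalOrder ℚ.≤-decTotalOrder using (totalOrder)
  import Data.List.Extrema totalOrder as Max
  import Data.List.Extrema (Flip.totalOrder totalOrder) as Min

  ∃-argmax : ∀ {n} (f : Fin (suc n) → ℚ) → ∃[ k ] ∀ i → f i ℚ.≤ f k
  ∃-argmax f = Max.argmax f zero (allFin _) ,
    λ i → All.lookup (Max.f[xs]≤f[argmax] {f = f} zero (allFin _)) (∈-allFin i)

  ∃-argmin : ∀ {n} (f : Fin (suc n) → ℚ) → ∃[ k ] ∀ i → f k ℚ.≤ f i
  ∃-argmin f = Min.argmax f zero (allFin _) ,
    λ i → All.lookup (Min.f[xs]≤f[argmax] {f = f} zero (allFin _)) (∈-allFin i)

^ℚ-nonNeg : ∀ {x} → 0ℚ ℚ.≤ x → ∀ n → 0ℚ ℚ.≤ x ^ℚ n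
^ℚ-nonNeg 0≤x zero    = 0≤1
^ℚ-nonNeg 0≤x (suc n) = *-nonNeg 0≤x (^ℚ-nonNeg 0≤x n)

^ℚ-monoˡ-≤ : ∀ {x y} → 0ℚ ℚ.≤ x → x ℚ.≤ y → ∀ n → x ^ℚ n ℚ.≤ y ^ℚ n
^ℚ-monoˡ-≤ 0≤x x≤y zero    = ℚ.≤-refl
^ℚ-monoˡ-≤ 0≤x x≤y (suc n) = *-mono-≤-nonNeg 0≤x (^ℚ-nonNeg 0≤x n) x≤y (^ℚ-monoˡ-≤ 0≤x x≤y n)

1≤^ℚ : ∀ {x} → 1ℚ ℚ.≤ x → ∀ n → 1ℚ ℚ.≤ x ^ℚ n
1≤^ℚ 1≤x zero    = ℚ.≤-refl
1≤^ℚ 1≤x (suc n) = *-mono-≤-nonNeg 0≤1 0≤1 1≤x (1≤^ℚ 1≤x n)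

^ℚ-monoʳ-≤ : ∀ {x} → 1ℚ ℚ.≤ x → ∀ {a b} → a ≤ b → x ^ℚ a ℚ.≤ x ^ℚ b
^ℚ-monoʳ-≤ 1≤x {b = b} z≤n = 1≤^ℚ 1≤x b
^ℚ-monoʳ-≤ {x} 1≤x (s≤s a≤b) =
  ℚ.*-monoˡ-≤-nonNeg x {{nonNegative (ℚ.≤-trans 0≤1 1≤x)}} (^ℚ-monoʳ-≤ 1≤x a≤b)

^ℚ-homo-+ : ∀ x a b → x ^ℚ (a ℕ.+ b) ≡ x ^ℚ a ℚ.* x ^ℚ b
^ℚ-homo-+ x zero    b = sym (ℚ.*-identityˡ _)
^ℚ-homo-+ x (suc a) b rewrite ^ℚ-homo-+ x a b = sym (ℚ.*-assoc x _ _)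

^ℚ-*-assoc : ∀ x a b → (x ^ℚ a) ^ℚ b ≡ x ^ℚ (b * a)
^ℚ-*-assoc x a zero    = refl
^ℚ-*-assoc x a (suc b) rewrite ^ℚ-*-assoc x a b = sym (^ℚ-homo-+ x a (b * a))

^ℚ-distrib-* : ∀ x y n → (x ℚ.* y) ^ℚ n ≡ x ^ℚ n ℚ.* y ^ℚ n
^ℚ-distrib-* x y zero    = refl
^ℚ-distrib-* x y (suc n) rewrite ^ℚ-distrib-* x y n =
  solve 4 (λ x y u v → (x :* y) :* (u :* v) := (x :* u) :* (y :* v)) refl x y (x ^ℚ n) (y ^ℚ n)

geometric-decay : ∀ {c} → 0ℚ ℚ.≤ c → ∀ {n} (t : Fin (suc n) → ℚ) →
                  (∀ i → c ℚ.* t (suc i) ℚ.≤ t (inject₁ i)) →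
                  c ^ℚ n ℚ.* t (fromℕ n) ℚ.≤ t zero
geometric-decay 0≤c {zero}  t _ = ℚ.≤-reflexive (ℚ.*-identityˡ (t zero))
geometric-decay {c} 0≤c {suc n} t decay = begin
  (c ℚ.* c ^ℚ n) ℚ.* t (fromℕ (suc n))  ≡⟨ ℚ.*-assoc c (c ^ℚ n) _ ⟩
  c ℚ.* (c ^ℚ n ℚ.* t (suc (fromℕ n)))  ≤⟨ ℚ.*-monoˡ-≤-nonNeg c {{nonNegative 0≤c}}
                                              (geometric-decay 0≤c (t ∘ suc) (decay ∘ suc)) ⟩
  c ℚ.* t (suc zero)                    ≤⟨ decay zero ⟩
  t zero                                ∎

cross5-next5 : ∀ k → cross5 (next5 k) ≡ next5 (next5 (cross5 k))
cross5-next5 zero                         = refl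
cross5-next5 (suc zero)                   = refl
cross5-next5 (suc (suc zero))             = refl
cross5-next5 (suc (suc (suc zero)))       = refl
cross5-next5 (suc (suc (suc (suc zero)))) = refl

-- The summands are the lengths of a 𝒫-path and of its detour as `len` computes them,
-- ending in the 0ℚ of the empty walk.
sum-cross5-pairs : ∀ (c a : Fin 5 → ℚ) →
  sum (λ k → c k + (a (cross5 k) + (a (next5 (cross5 k)) + 0ℚ))) ≡ sum c + two ℚ.* sum a
sum-cross5-pairs c a = solve 10
  (λ c₀ c₁ c₂ c₃ c₄ a₀ a₁ a₂ a₃ a₄ →
       c₀ :+ (a₀ :+ (a₁ :+ con 0ℚ)) :+ (c₁ :+ (a₂ :+ (a₃ :+ con 0ℚ)) :+ (c₂ :+ (a₄ :+ (a₀ :+ con 0ℚ))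
    :+ (c₃ :+ (a₁ :+ (a₂ :+ con 0ℚ)) :+ (c₄ :+ (a₃ :+ (a₄ :+ con 0ℚ)) :+ con 0ℚ))))
    := c₀ :+ (c₁ :+ (c₂ :+ (c₃ :+ (c₄ :+ con 0ℚ))))
       :+ (con 1ℚ :+ con 1ℚ) :* (a₀ :+ (a₁ :+ (a₂ :+ (a₃ :+ (a₄ :+ con 0ℚ))))))
  refl (c zero) (c (suc zero)) (c (suc (suc zero))) (c (suc (suc (suc zero)))) (c (suc (suc (suc (suc zero)))))
       (a zero) (a (suc zero)) (a (suc (suc zero))) (a (suc (suc (suc zero)))) (a (suc (suc (suc (suc zero)))))

sum-next5-shift : ∀ (b c : Fin 5 → ℚ) → sum (λ k → b k + (c (next5 k) + 0ℚ)) ≡ sum c + sum b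
sum-next5-shift b c = solve 10
  (λ b₀ b₁ b₂ b₃ b₄ c₀ c₁ c₂ c₃ c₄ →
       b₀ :+ (c₁ :+ con 0ℚ) :+ (b₁ :+ (c₂ :+ con 0ℚ) :+ (b₂ :+ (c₃ :+ con 0ℚ)
    :+ (b₃ :+ (c₄ :+ con 0ℚ) :+ (b₄ :+ (c₀ :+ con 0ℚ) :+ con 0ℚ))))
    := c₀ :+ (c₁ :+ (c₂ :+ (c₃ :+ (c₄ :+ con 0ℚ))))
       :+ (b₀ :+ (b₁ :+ (b₂ :+ (b₃ :+ (b₄ :+ con 0ℚ))))))
  refl (b zero) (b (suc zero)) (b (suc (suc zero))) (b (suc (suc (suc zero)))) (b (suc (suc (suc (suc zero)))))
       (c zero) (c (suc zero)) (c (suc (suc zero))) (c (suc (suc (suc zero)))) (c (suc (suc (suc (suc zero)))))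

module _ {m : ℕ} (w : Edge m → ℚ) where

  cycleWeight : Fin m → ℚ
  cycleWeight i = sum (λ k → w (cyc i k))

  detour : (i j : Fin m) (p : toℕ j ≡ suc (toℕ i)) (k : Fin 5) →
           Walk {m} (i , k) (j , next5 (next5 (cross5 k)))
  detour i j p k =
    step (cyc i k) (inj₁ refl)
      (step (cross i j p (next5 k)) (inj₁ (cong (λ v → (i , next5 k) , (j , v)) (cross5-next5 k)))
        [])

  cycleWeight-halves : AllPShortest w → (i j : Fin m) → toℕ j ≡ suc (toℕ i) →
                       two ℚ.* cycleWeight j ℚ.≤ cycleWeight i
  cycleWeight-halves shortest i j p = +-cancelˡ-≤ (sum crossWeight) (begin
    sum crossWeight + two ℚ.* cycleWeight j  ≡⟨ sym (sum-cross5-pairs crossWeight (λ k → w (cyc j k))) ⟩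
    sum (λ k → len w (pPath i j p k))        ≤⟨ sum-mono-≤ (λ k → shortest i j p k (detour i j p k)) ⟩
    sum (λ k → len w (detour i j p k))       ≡⟨ sum-next5-shift (λ k → w (cyc i k)) crossWeight ⟩
    sum crossWeight + cycleWeight i          ∎)
    where
    crossWeight : Fin 5 → ℚ
    crossWeight k = w (cross i j p k)

cycleWeight-decays : ∀ {n} (w : Edge (suc n) → ℚ) → AllPShortest w →
                     two ^ℚ n ℚ.* cycleWeight w (fromℕ n) ℚ.≤ cycleWeight w zero
cycleWeight-decays w shortest = geometric-decay 0≤two (cycleWeight w)
  (λ i → cycleWeight-halves w shortest (inject₁ i) (suc i) (cong suc (sym (toℕ-inject₁ i))))

∃-2^n*w[e′]≤w[e] : ∀ {n} (w : Edge (suc n) → ℚ) → AllPShortest w →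
                   Σ (Edge (suc n)) λ e → Σ (Edge (suc n)) λ e′ → two ^ℚ n ℚ.* w e′ ℚ.≤ w e
∃-2^n*w[e′]≤w[e] {n} w shortest =
  let heaviest , ≤heaviest = ∃-argmax (λ k → w (cyc zero k))
      lightest , lightest≤ = ∃-argmin (λ k → w (cyc (fromℕ n) k))
      heavy = w (cyc zero heaviest)
      light = w (cyc (fromℕ n) lightest)
  in cyc zero heaviest , cyc (fromℕ n) lightest , ℚ.*-cancelˡ-≤-pos five (begin
    five ℚ.* (two ^ℚ n ℚ.* light)            ≡⟨ solve 3 (λ f t l → f :* (t :* l) := t :* (f :* l))
                                                   refl five (two ^ℚ n) light ⟩
    two ^ℚ n ℚ.* (five ℚ.* light)            ≡⟨ cong (two ^ℚ n ℚ.*_) (sym (sum-const₅ light)) ⟩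
    two ^ℚ n ℚ.* sum {5} (λ _ → light)       ≤⟨ ℚ.*-monoˡ-≤-nonNeg (two ^ℚ n) {{nonNegative (^ℚ-nonNeg 0≤two n)}}
                                                   (sum-mono-≤ lightest≤) ⟩
    two ^ℚ n ℚ.* cycleWeight w (fromℕ n)     ≤⟨ cycleWeight-decays w shortest ⟩
    cycleWeight w zero                       ≤⟨ sum-mono-≤ ≤heaviest ⟩
    sum {5} (λ _ → heavy)                    ≡⟨ sum-const₅ heavy ⟩
    five ℚ.* heavy                           ∎)

aspectRatioPowAtLeast-k*n : ∀ {n} (w : Edge (suc n) → ℚ) → Positive w → AllPShortest w →
                     ∀ k → AspectRatioPowAtLeast w k (k * n)
aspectRatioPowAtLeast-k*n {n} w positive shortest k =
  let e , e′ , ratio = ∃-2^n*w[e′]≤w[e] w shortest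
  in e , e′ , (begin
    two ^ℚ (k * n) ℚ.* w e′ ^ℚ k   ≡⟨ cong (ℚ._* w e′ ^ℚ k) (sym (^ℚ-*-assoc two n k)) ⟩
    (two ^ℚ n) ^ℚ k ℚ.* w e′ ^ℚ k  ≡⟨ sym (^ℚ-distrib-* (two ^ℚ n) (w e′) k) ⟩
    (two ^ℚ n ℚ.* w e′) ^ℚ k       ≤⟨ ^ℚ-monoˡ-≤ (*-nonNeg (^ℚ-nonNeg 0≤two n) (ℚ.<⇒≤ (positive e′))) ratio k ⟩
    w e ^ℚ k                       ∎)

aspectRatioPowAtLeast-antitone : ∀ {m} {w : Edge m → ℚ} → Positive w → ∀ {k E F} → E ≤ F →
                                 AspectRatioPowAtLeast w k F → AspectRatioPowAtLeast w k E
aspectRatioPowAtLeast-antitone {w = w} positive {k} E≤F (e , e′ , ratio) = e , e′ ,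
  ℚ.≤-trans (ℚ.*-monoʳ-≤-nonNeg (w e′ ^ℚ k) {{nonNegative (^ℚ-nonNeg (ℚ.<⇒≤ (positive e′)) k)}}
                                (^ℚ-monoʳ-≤ 1≤two E≤F))
            ratio

5*[2+n]≤10*[1+n] : ∀ n → 5 * (2 ℕ.+ n) ≤ 10 * (1 ℕ.+ n)
5*[2+n]≤10*[1+n] n = ℕ.≤-trans (ℕ.m≤m+n (5 * (2 ℕ.+ n)) (5 * n)) (ℕ.≤-reflexive (identity n))
  where
  identity : ∀ n → 5 * (2 ℕ.+ n) ℕ.+ 5 * n ≡ 10 * (1 ℕ.+ n)
  identity = solve-∀

lemma3p2 : Σ ℕ λ k → 1 ≤ k × Σ ℕ λ N →
    (m : ℕ) → N ≤ 5 * m → (w : Edge m → ℚ) → Positive w → AllPShortest w →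
    AspectRatioPowAtLeast w k (5 * m)
lemma3p2 = 10 , s≤s z≤n , 10 , bound
  where
  bound : (m : ℕ) → 10 ≤ 5 * m → (w : Edge m → ℚ) → Positive w → AllPShortest w →
          AspectRatioPowAtLeast w 10 (5 * m)
  bound (suc (suc n)) _ w positive shortest =
    aspectRatioPowAtLeast-antitone positive {k = 10} (5*[2+n]≤10*[1+n] n)
      (aspectRatioPowAtLeast-k*n w positive shortest 10)
  bound (suc zero) (s≤s (s≤s (s≤s (s≤s (s≤s ())))))
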